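{- Let $n\ge m\ge 1$. Then $\lambda_3(m,n)\le mn/4$, and $\lambda_4(m,n)\le (1+o(1))\, m^2 n/8$ (as $n\to\infty$).
   Context: $K_{m,n}$ denotes the complete bipartite graph with vertex classes $M$, $|M|=m$, and $N$, $|N|=n$. A path is alternating if any two adjacent edges of it have different colors; the length of a path is its number of edges. $\lambda_{\ell}(m,n)$ is the maximum $t$ such that there is a $2$-edge-coloring of $K_{m,n}$ in which every pair of vertices is connected by $t$ (not necessarily internally disjoint) alternating paths of length $\ell$; for even $\ell$ only pairs of distinct vertices in the class $N$ of size $n$ are considered, and for odd $\ell$ the pairs consist of one vertex from each class. -}

module Defs where

open import Data.Nat using (ℕ; zero; suc)
open import Data.Fin using (Fin)
open import Data.Bool using (Bool; true; false)
open import Data.Maybe using (Maybe; just; nothing)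
open import Data.Sum using (_⊎_; inj₁; inj₂)
open import Data.Product using (Σ; _×_)
open import Data.Unit using (⊤)
open import Data.Empty using (⊥)
open import Data.List using (List; []; _∷_; length; head; last)
open import Data.List.Relation.Unary.Unique.Propositional using (Unique)
open import Relation.Binary.PropositionalEquality using (_≡_; _≢_)

-- Vertices of K_{m,n}: inj₁ = class M (size m), inj₂ = class N (size n).
Vertex : ℕ → ℕ → Set
Vertex m n = Fin m ⊎ Fin n

Coloring : ℕ → ℕ → Set
Coloring m n = Fin m → Fin n → Bool

EdgeCol : ∀ {m n} → Coloring m n → Vertex m n → Vertex m n → Bool → Set
EdgeCol c (inj₁ x) (inj₂ y) b = c x y ≡ b
EdgeCol c (inj₂ y) (inj₁ x) b = c x y ≡ b
EdgeCol c (inj₁ _) (inj₁ _) b = ⊥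
EdgeCol c (inj₂ _) (inj₂ _) b = ⊥

-- Alternating c prev vs : consecutive vertices of vs are adjacent, and any two
-- adjacent edges have different colours (prev = colour of the preceding edge, if any).
Alternating : ∀ {m n} → Coloring m n → Maybe Bool → List (Vertex m n) → Set
Alternating c prev [] = ⊤
Alternating c prev (v ∷ []) = ⊤
Alternating c prev (v ∷ w ∷ rest) =
  Σ Bool (λ b → EdgeCol c v w b × (prev ≢ just b) × Alternating c (just b) (w ∷ rest))

record AltPath {m n : ℕ} (c : Coloring m n) (ℓ : ℕ) (s t : Vertex m n) : Set where
  field
    vs     : List (Vertex m n)
    len    : length vs ≡ suc ℓ
    start  : head vs ≡ just s
    end    : last vs ≡ just t
    path   : Unique vs
    alt    : Alternating c nothing vs

ConnectedBy : ∀ {m n} → Coloring m n → ℕ → Vertex m n → Vertex m n → ℕ → Set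
ConnectedBy c ℓ s t k =
  Σ (Fin k → AltPath c ℓ s t)
    (λ P → ∀ i j → AltPath.vs (P i) ≡ AltPath.vs (P j) → i ≡ j)

isEven : ℕ → Bool
isEven zero = true
isEven (suc zero) = false
isEven (suc (suc k)) = isEven k

AllPairsConnected : ∀ {m n} → Coloring m n → ℕ → ℕ → Set
AllPairsConnected {m} {n} c ℓ t with isEven ℓ
... | true  = (y y′ : Fin n) → y ≢ y′ → ConnectedBy c ℓ (inj₂ y) (inj₂ y′) t
... | false = (x : Fin m) (y : Fin n) → ConnectedBy c ℓ (inj₁ x) (inj₂ y) t

-- t is achievable for λ_ℓ(m,n); λ_ℓ(m,n) is the maximum achievable t, so
-- "λ_ℓ(m,n) ≤ B" means: every achievable t satisfies t ≤ B.
Achievable : ℕ → ℕ → ℕ → ℕ → Set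
Achievable ℓ m n t = Σ (Coloring m n) (λ c → AllPairsConnected c ℓ t)

-- Count alternating walks in two ways.  An alternating path x y′ x′ y of length 3 is determined by
-- (x′, y′), so if every pair (x, y) ∈ M × N is joined by t such paths there are at least m n t
-- alternating walks of length 3 from M to N.  Group them by their two M-vertices x, x′, and let A, B
-- count the columns on which the rows x, x′ differ (one way or the other) and C, D those on which
-- they agree: the walks through x, x′ in either order number 4AB + (A + B)(C + D) ≤ n (A + B) by
-- AM-GM, and A + B is the Hamming distance of the two rows.  Over all ordered pairs of rows these
-- distances add up to at most n m²/2, since a column with r entries of one colour contributes
-- 2r(m − r) ≤ m²/2.  Hence 4 · #walks ≤ n² m², i.e. 4t ≤ mn.  For length 4 the same grouping by the
-- two M-vertices of y x₁ y₂ x₂ y′ gives at most n² (A + B)/4 walks per pair of rows, so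
-- 8 · #walks ≤ n³ m², while the n (n − 1) ordered pairs of distinct vertices of N contribute at
-- least n (n − 1) t walks; the ratio n/(n − 1) is the 1 + o(1).

module Submission where

open import Defs
open import Data.Nat using (ℕ; zero; suc; _+_; _*_; _≤_; z≤n; s≤s)
open import Data.Nat.Properties
  using (+-*-semiring; ≤-reflexive; ≤-trans; ≤-total; +-mono-≤; +-monoˡ-≤; *-monoʳ-≤; m≤m+n; m≤n+m;
         m≤n⇒∃[o]m+o≡n; *-cancelˡ-≤; *-identityʳ; +-assoc; *-assoc; *-suc; module ≤-Reasoning)
open import Data.Nat.Tactic.RingSolver using (solve-∀)
open import Data.Bool using (Bool; true; false; not)
open import Data.Maybe using (just)
open import Data.Fin using (Fin; zero; suc; punchIn; punchOut; combine; remQuot; _↑ˡ_; _↑ʳ_; _≟_)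
open import Data.Fin.Properties
  using (injective⇒≤; any?; punchInᵢ≢i; punchIn-injective; punchOut-injective; punchIn-punchOut;
         remQuot-combine; combine-injective)
open import Data.Sum using (inj₁; inj₂; [_,_]′)
open import Data.Empty using (⊥-elim)
open import Data.Product using (Σ; ∃; ∃-syntax; _×_; _,_; proj₁; proj₂; uncurry; map₂)
open import Data.List using (List; []; _∷_)
open import Function using (_∘_; Injective)
open import Relation.Nullary using (Dec; yes; no)
open import Relation.Binary.PropositionalEquality
open import Algebra.Properties.Semiring.Sum +-*-semiring
  using (sum-syntax; sum-cong-≗; ∑-comm; ∑-distrib-+; sum-remove; *-distribˡ-sum; *-distribʳ-sum)

∑-const : ∀ n k → ∑[ i < n ] k ≡ n * k
∑-const zero    k = refl
∑-const (suc n) k = cong (k +_) (∑-const n k)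

∑∑-const : ∀ m n k → ∑[ x < m ] ∑[ y < n ] k ≡ m * (n * k)
∑∑-const m n k = trans (sum-cong-≗ {m} λ _ → ∑-const n k) (∑-const m (n * k))

∑-one : ∀ n → ∑[ i < n ] 1 ≡ n
∑-one n = trans (∑-const n 1) (*-identityʳ n)

*-distribˡ-∑∑ : ∀ {m n} k (f : Fin m → Fin n → ℕ) →
                k * ∑[ x < m ] ∑[ y < n ] f x y ≡ ∑[ x < m ] ∑[ y < n ] (k * f x y)
*-distribˡ-∑∑ {m} {n} k f =
  trans (*-distribˡ-sum k (λ x → ∑[ y < n ] f x y)) (sum-cong-≗ λ x → *-distribˡ-sum k (f x))

∑∑-+-transpose : ∀ {m} (f : Fin m → Fin m → ℕ) →
                 ∑[ x < m ] ∑[ x′ < m ] f x x′ + ∑[ x < m ] ∑[ x′ < m ] f x x′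
                   ≡ ∑[ x < m ] ∑[ x′ < m ] (f x x′ + f x′ x)
∑∑-+-transpose {m} f = trans (cong (∑[ x < m ] ∑[ x′ < m ] f x x′ +_) (∑-comm f))
  (trans (sym (∑-distrib-+ (λ x → ∑[ x′ < m ] f x x′) (λ x → ∑[ x′ < m ] f x′ x)))
         (sum-cong-≗ λ x → sym (∑-distrib-+ (f x) (λ x′ → f x′ x))))

∑-mono-≤ : ∀ {n} {f g : Fin n → ℕ} → (∀ i → f i ≤ g i) → ∑[ i < n ] f i ≤ ∑[ i < n ] g i
∑-mono-≤ {zero}  f≤g = z≤n
∑-mono-≤ {suc n} f≤g = +-mono-≤ (f≤g zero) (∑-mono-≤ (f≤g ∘ suc))

∑∑-factor : ∀ {k l} (d : ℕ) (a : Fin k → ℕ) (e : Fin l → ℕ) →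
            ∑[ i < k ] ∑[ j < l ] (d * (a i * e j)) ≡ d * (∑[ i < k ] a i * ∑[ j < l ] e j)
∑∑-factor {k} {l} d a e = begin
  ∑[ i < k ] ∑[ j < l ] (d * (a i * e j))  ≡⟨ sum-cong-≗ (λ i → sym (*-distribˡ-sum d (λ j → a i * e j))) ⟩
  ∑[ i < k ] (d * ∑[ j < l ] (a i * e j))  ≡⟨ sum-cong-≗ (λ i → cong (d *_) (sym (*-distribˡ-sum (a i) e))) ⟩
  ∑[ i < k ] (d * (a i * ∑[ j < l ] e j))  ≡⟨ sym (*-distribˡ-sum d (λ i → a i * ∑[ j < l ] e j)) ⟩
  d * ∑[ i < k ] (a i * ∑[ j < l ] e j)    ≡⟨ cong (d *_) (sym (*-distribʳ-sum (∑[ j < l ] e j) a)) ⟩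
  d * (∑[ i < k ] a i * ∑[ j < l ] e j)    ∎
  where open ≡-Reasoning

off-diagonal-≤-∑∑ : ∀ {n t} (f : Fin (suc n) → Fin (suc n) → ℕ) → (∀ y y′ → y ≢ y′ → t ≤ f y y′) →
                    suc n * (n * t) ≤ ∑[ y < suc n ] ∑[ y′ < suc n ] f y y′
off-diagonal-≤-∑∑ {n} {t} f t≤f = begin
  suc n * (n * t)                       ≡⟨ sym (∑-const (suc n) (n * t)) ⟩
  ∑[ y < suc n ] (n * t)                ≤⟨ ∑-mono-≤ row ⟩
  ∑[ y < suc n ] ∑[ y′ < suc n ] f y y′ ∎
  where
  open ≤-Reasoning
  row : ∀ y → n * t ≤ ∑[ y′ < suc n ] f y y′
  row y = begin
    n * t                                   ≡⟨ sym (∑-const n t) ⟩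
    ∑[ j < n ] t                            ≤⟨ ∑-mono-≤ (λ j → t≤f y (punchIn y j) (punchInᵢ≢i y j ∘ sym)) ⟩
    ∑[ j < n ] f y (punchIn y j)            ≤⟨ m≤n+m _ (f y y) ⟩
    f y y + ∑[ j < n ] f y (punchIn y j)    ≡⟨ sym (sum-remove {i = y} (f y)) ⟩
    ∑[ y′ < suc n ] f y y′                  ∎

∑-↑ : ∀ m {n} (f : Fin (m + n) → ℕ) →
      ∑[ k < m + n ] f k ≡ ∑[ i < m ] f (i ↑ˡ n) + ∑[ j < n ] f (m ↑ʳ j)
∑-↑ zero    f = refl
∑-↑ (suc m) f = trans (cong (f zero +_) (∑-↑ m (f ∘ suc))) (sym (+-assoc (f zero) _ _))

∑-combine : ∀ m {n} (f : Fin (m * n) → ℕ) →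
            ∑[ k < m * n ] f k ≡ ∑[ i < m ] ∑[ j < n ] f (combine i j)
∑-combine zero    f = refl
∑-combine (suc m) {n} f =
  trans (∑-↑ n f) (cong (∑[ j < n ] f (j ↑ˡ (m * n)) +_) (∑-combine m (f ∘ (n ↑ʳ_))))

∑-remQuot : ∀ m {n} (f : Fin m × Fin n → ℕ) →
            ∑[ k < m * n ] f (remQuot n k) ≡ ∑[ i < m ] ∑[ j < n ] f (i , j)
∑-remQuot m f = trans (∑-combine m (f ∘ remQuot _))
  (sum-cong-≗ λ i → sum-cong-≗ λ j → cong f (remQuot-combine i j))

∑-inward₃ : ∀ {k l m n} (f : Fin k → Fin l → Fin m → Fin n → ℕ) →
            ∑[ i < k ] ∑[ a < l ] ∑[ b < m ] ∑[ c < n ] f i a b c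
              ≡ ∑[ a < l ] ∑[ b < m ] ∑[ c < n ] ∑[ i < k ] f i a b c
∑-inward₃ f = trans (∑-comm λ i a → ∑[ b < _ ] ∑[ c < _ ] f i a b c)
  (sum-cong-≗ λ a → trans (∑-comm λ i b → ∑[ c < _ ] f i a b c)
    (sum-cong-≗ λ b → ∑-comm λ i c → f i a b c))

injective⇒≤-∑ : ∀ {t k} (w : Fin k → ℕ) (f : Fin t → Fin k) → Injective _≡_ _≡_ f →
                (∀ i → 1 ≤ w (f i)) → t ≤ ∑[ j < k ] w j
injective⇒≤-∑ {k = zero}      w f inj pos = injective⇒≤ inj
injective⇒≤-∑ {zero} {suc k}  w f inj pos = z≤n
injective⇒≤-∑ {suc t} {suc k} w f inj pos = byZero (any? (λ i → f i ≟ zero))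
  where
  avoiding : ∀ {s} (g : Fin s → Fin (suc k)) → Injective _≡_ _≡_ g → (∀ i → zero ≢ g i) →
             (∀ i → 1 ≤ w (g i)) → s ≤ ∑[ j < k ] w (suc j)
  avoiding g g-inj avoid g-pos = injective⇒≤-∑ (w ∘ suc) (λ i → punchOut (avoid i))
    (λ eq → g-inj (punchOut-injective (avoid _) (avoid _) eq))
    (λ i → subst (λ j → 1 ≤ w j) (sym (punchIn-punchOut (avoid i))) (g-pos i))

  byZero : Dec (∃ λ i → f i ≡ zero) → suc t ≤ ∑[ j < suc k ] w j
  byZero (no f≢0) = ≤-trans (avoiding f inj (λ i 0≡fi → f≢0 (i , sym 0≡fi)) pos) (m≤n+m _ (w zero))
  byZero (yes (i , fi≡0)) = +-mono-≤ (subst (λ j → 1 ≤ w j) fi≡0 (pos i))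
    (avoiding (f ∘ punchIn i) (punchIn-injective i _ _ ∘ inj)
      (λ j 0≡f → punchInᵢ≢i i j (inj (trans (sym 0≡f) (sym fi≡0)))) (pos ∘ punchIn i))

injective⇒≤-∑∑ : ∀ {t m n} (w : Fin m → Fin n → ℕ) (f : Fin t → Fin m × Fin n) →
                 Injective _≡_ _≡_ f → (∀ i → 1 ≤ uncurry w (f i)) →
                 t ≤ ∑[ x < m ] ∑[ y < n ] w x y
injective⇒≤-∑∑ {t} {m} {n} w f inj pos = subst (t ≤_) (∑-remQuot m (uncurry w))
  (injective⇒≤-∑ (uncurry w ∘ remQuot n) (uncurry combine ∘ f) combine-inj
    (λ i → subst (λ q → 1 ≤ uncurry w q) (sym (remQuot-combine _ _)) (pos i)))
  where
  combine-inj : Injective _≡_ _≡_ (uncurry combine ∘ f)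
  combine-inj eq with combine-injective _ _ _ _ eq
  ... | eq₁ , eq₂ = inj (cong₂ _,_ eq₁ eq₂)

injective⇒≤-∑∑∑ : ∀ {t l m n} (w : Fin l → Fin m → Fin n → ℕ) (f : Fin t → Fin l × Fin m × Fin n) →
                  Injective _≡_ _≡_ f → (∀ i → 1 ≤ uncurry (uncurry ∘ w) (f i)) →
                  t ≤ ∑[ x < l ] ∑[ y < m ] ∑[ z < n ] w x y z
injective⇒≤-∑∑∑ {t} {l} {m} {n} w f inj pos =
  subst (t ≤_) (sum-cong-≗ λ x → ∑-remQuot m (uncurry (w x)))
    (injective⇒≤-∑∑ (λ x → uncurry (w x) ∘ remQuot n) (map₂ (uncurry combine) ∘ f) combine-inj
      (λ i → subst (λ q → 1 ≤ uncurry (w (proj₁ (f i))) q) (sym (remQuot-combine _ _)) (pos i)))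
  where
  combine-inj : Injective _≡_ _≡_ (map₂ (uncurry combine) ∘ f)
  combine-inj eq with combine-injective _ _ _ _ (cong proj₂ eq)
  ... | eq₂ , eq₃ = inj (cong₂ _,_ (cong proj₁ eq) (cong₂ _,_ eq₂ eq₃))

4*m*n≤[m+n]² : ∀ m n → 4 * m * n ≤ (m + n) * (m + n)
4*m*n≤[m+n]² m n = [ ordered , subst₂ _≤_ (swap₁ n m) (swap₂ n m) ∘ ordered ]′ (≤-total m n)
  where
  ordered : ∀ {a b} → a ≤ b → 4 * a * b ≤ (a + b) * (a + b)
  ordered {a} a≤b with k , refl ← m≤n⇒∃[o]m+o≡n a≤b =
    subst (4 * a * (a + k) ≤_) (square a k) (m≤m+n _ (k * k))
    where square : ∀ a k → 4 * a * (a + k) + k * k ≡ (a + (a + k)) * (a + (a + k))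
          square = solve-∀
  swap₁ : ∀ a b → 4 * a * b ≡ 4 * b * a
  swap₁ = solve-∀
  swap₂ : ∀ a b → (a + b) * (a + b) ≡ (b + a) * (b + a)
  swap₂ = solve-∀

a≤n⇒a*[1+n]≤[a+1]*n : ∀ {a n} → a ≤ n → a * suc n ≤ (a + 1) * n
a≤n⇒a*[1+n]≤[a+1]*n {a} {n} a≤n = begin
  a * suc n    ≡⟨ *-suc a n ⟩
  a + a * n    ≤⟨ +-monoˡ-≤ (a * n) a≤n ⟩
  n + a * n    ≡⟨ distrib a n ⟩
  (a + 1) * n  ∎
  where
  open ≤-Reasoning
  distrib : ∀ a n → n + a * n ≡ (a + 1) * n
  distrib = solve-∀

δ : Bool → Bool → ℕ
δ true  true  = 1
δ false false = 1
δ _     _     = 0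

-- Through δ, so that ∑[ y < n ] diff b (h y) is literally colour h (not b).
diff : Bool → Bool → ℕ
diff a b = δ (not a) b

diff-comm : ∀ a b → diff a b ≡ diff b a
diff-comm true  true  = refl
diff-comm true  false = refl
diff-comm false true  = refl
diff-comm false false = refl

colours≢⇒diff≡1 : ∀ {a a′ b b′} → a ≡ b → a′ ≡ b′ → just b ≢ just b′ → diff a a′ ≡ 1
colours≢⇒diff≡1 {b = true}  {true}  refl refl b≢b′ = ⊥-elim (b≢b′ refl)
colours≢⇒diff≡1 {b = true}  {false} refl refl _    = refl
colours≢⇒diff≡1 {b = false} {true}  refl refl _    = refl
colours≢⇒diff≡1 {b = false} {false} refl refl b≢b′ = ⊥-elim (b≢b′ refl)

colour : ∀ {n} → (Fin n → Bool) → Bool → ℕ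
colour {n} g b = ∑[ y < n ] δ b (g y)

hamming : ∀ {n} → (Fin n → Bool) → (Fin n → Bool) → ℕ
hamming {n} g h = ∑[ y < n ] diff (g y) (h y)

columns : ∀ {n} → (Fin n → Bool) → (Fin n → Bool) → Bool → Bool → ℕ
columns {n} g h u v = ∑[ y < n ] (δ u (g y) * δ v (h y))

∑-byColour : ∀ {n} (g : Fin n → Bool) (F : Bool → ℕ) →
             ∑[ y < n ] F (g y) ≡ F true * colour g true + F false * colour g false
∑-byColour {zero}  g F = lemma (F true) (F false)
  where lemma : ∀ a b → 0 ≡ a * 0 + b * 0
        lemma = solve-∀
∑-byColour {suc n} g F = trans (cong (F (g zero) +_) (∑-byColour (g ∘ suc) F)) (step (g zero))
  where
  step : ∀ u → F u + (F true * colour (g ∘ suc) true + F false * colour (g ∘ suc) false)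
             ≡ F true * (δ true u + colour (g ∘ suc) true) + F false * (δ false u + colour (g ∘ suc) false)
  step true  = lemma (F true) (F false) _ _
    where lemma : ∀ a b r s → a + (a * r + b * s) ≡ a * suc r + b * s
          lemma = solve-∀
  step false = lemma (F true) (F false) _ _
    where lemma : ∀ a b r s → b + (a * r + b * s) ≡ a * r + b * suc s
          lemma = solve-∀

∑-byColumnType : ∀ {n} (g h : Fin n → Bool) (F : Bool → Bool → ℕ) →
  ∑[ y < n ] F (g y) (h y) ≡ F true false * columns g h true false + F false true * columns g h false true
                           + F false false * columns g h false false + F true true * columns g h true true
∑-byColumnType {zero} g h F = lemma (F true false) (F false true) (F false false) (F true true)
  where lemma : ∀ a b c d → 0 ≡ a * 0 + b * 0 + c * 0 + d * 0
        lemma = solve-∀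
∑-byColumnType {suc n} g h F =
  trans (cong (F (g zero) (h zero) +_) (∑-byColumnType (g ∘ suc) (h ∘ suc) F)) (step (g zero) (h zero))
  where
  a b c d A B C D : ℕ
  a = F true false
  b = F false true
  c = F false false
  d = F true true
  A = columns (g ∘ suc) (h ∘ suc) true false
  B = columns (g ∘ suc) (h ∘ suc) false true
  C = columns (g ∘ suc) (h ∘ suc) false false
  D = columns (g ∘ suc) (h ∘ suc) true true
  step : ∀ u v → F u v + (a * A + b * B + c * C + d * D)
                 ≡ a * (δ true u * δ false v + A) + b * (δ false u * δ true v + B)
                 + c * (δ false u * δ false v + C) + d * (δ true u * δ true v + D)
  step true false = lemma a b c d A B C D
    where lemma : ∀ a b c d A B C D → a + (a * A + b * B + c * C + d * D) ≡ a * suc A + b * B + c * C + d * D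
          lemma = solve-∀
  step false true = lemma a b c d A B C D
    where lemma : ∀ a b c d A B C D → b + (a * A + b * B + c * C + d * D) ≡ a * A + b * suc B + c * C + d * D
          lemma = solve-∀
  step false false = lemma a b c d A B C D
    where lemma : ∀ a b c d A B C D → c + (a * A + b * B + c * C + d * D) ≡ a * A + b * B + c * suc C + d * D
          lemma = solve-∀
  step true true = lemma a b c d A B C D
    where lemma : ∀ a b c d A B C D → d + (a * A + b * B + c * C + d * D) ≡ a * A + b * B + c * C + d * suc D
          lemma = solve-∀

walks₃ : ∀ {n} → (Fin n → Bool) → (Fin n → Bool) → ℕ
walks₃ {n} g h = ∑[ y < n ] (diff (g y) (h y) * colour h (not (h y)))

walks₄ : ∀ {n} → (Fin n → Bool) → (Fin n → Bool) → ℕ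
walks₄ {n} g h = ∑[ y < n ] (diff (g y) (h y) * (colour g (not (g y)) * colour h (not (h y))))

module RowPair {n : ℕ} (g h : Fin n → Bool) where

  A B C D : ℕ
  A = columns g h true false
  B = columns g h false true
  C = columns g h false false
  D = columns g h true true

  n≡A+B+C+D : n ≡ A + B + C + D
  n≡A+B+C+D = begin
    n                                 ≡⟨ sym (∑-one n) ⟩
    ∑[ y < n ] 1                      ≡⟨ ∑-byColumnType g h (λ _ _ → 1) ⟩
    1 * A + 1 * B + 1 * C + 1 * D     ≡⟨ lemma A B C D ⟩
    A + B + C + D                     ∎
    where open ≡-Reasoning
          lemma : ∀ a b c d → 1 * a + 1 * b + 1 * c + 1 * d ≡ a + b + c + d
          lemma = solve-∀

  hamming≡A+B : hamming g h ≡ A + B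
  hamming≡A+B = trans (∑-byColumnType g h diff) (lemma A B C D)
    where lemma : ∀ a b c d → 1 * a + 1 * b + 0 * c + 0 * d ≡ a + b
          lemma = solve-∀

  colour-g-true : colour g true ≡ A + D
  colour-g-true = trans (∑-byColumnType g h (λ u _ → δ true u)) (lemma A B C D)
    where lemma : ∀ a b c d → 1 * a + 0 * b + 0 * c + 1 * d ≡ a + d
          lemma = solve-∀

  colour-g-false : colour g false ≡ B + C
  colour-g-false = trans (∑-byColumnType g h (λ u _ → δ false u)) (lemma A B C D)
    where lemma : ∀ a b c d → 0 * a + 1 * b + 1 * c + 0 * d ≡ b + c
          lemma = solve-∀

  colour-h-true : colour h true ≡ B + D
  colour-h-true = trans (∑-byColumnType g h (λ _ v → δ true v)) (lemma A B C D)
    where lemma : ∀ a b c d → 0 * a + 1 * b + 0 * c + 1 * d ≡ b + d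
          lemma = solve-∀

  colour-h-false : colour h false ≡ A + C
  colour-h-false = trans (∑-byColumnType g h (λ _ v → δ false v)) (lemma A B C D)
    where lemma : ∀ a b c d → 1 * a + 0 * b + 1 * c + 0 * d ≡ a + c
          lemma = solve-∀

  ∑-differing : (K : Bool → Bool → ℕ) →
                ∑[ y < n ] (diff (g y) (h y) * K (g y) (h y)) ≡ K true false * A + K false true * B
  ∑-differing K = trans (∑-byColumnType g h (λ u v → diff u v * K u v))
    (lemma (K true false) (K false true) (K false false) (K true true) A B C D)
    where lemma : ∀ k l o p a b c d → 1 * k * a + 1 * l * b + 0 * o * c + 0 * p * d ≡ k * a + l * b
          lemma = solve-∀

  walks₃-≤ : walks₃ g h + walks₃ h g ≤ n * hamming g h
  walks₃-≤ = begin
    walks₃ g h + walks₃ h g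
      ≡⟨ cong₂ _+_ (∑-differing λ _ v → colour h (not v))
                   (trans (sum-cong-≗ λ y → cong (_* colour g (not (g y))) (diff-comm (h y) (g y)))
                          (∑-differing λ u _ → colour g (not u))) ⟩
    colour h true * A + colour h false * B + (colour g false * A + colour g true * B)
      ≡⟨ cong₂ _+_ (cong₂ (λ p q → p * A + q * B) colour-h-true colour-h-false)
                   (cong₂ (λ p q → p * A + q * B) colour-g-false colour-g-true) ⟩
    (B + D) * A + (A + C) * B + ((B + C) * A + (A + D) * B)
      ≡⟨ expand A B C D ⟩
    4 * A * B + (A + B) * (C + D)
      ≤⟨ +-monoˡ-≤ ((A + B) * (C + D)) (4*m*n≤[m+n]² A B) ⟩
    (A + B) * (A + B) + (A + B) * (C + D)
      ≡⟨ factor A B C D ⟩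
    (A + B + C + D) * (A + B)
      ≡⟨ sym (cong₂ _*_ n≡A+B+C+D hamming≡A+B) ⟩
    n * hamming g h ∎
    where
    open ≤-Reasoning
    expand : ∀ a b c d → (b + d) * a + (a + c) * b + ((b + c) * a + (a + d) * b) ≡ 4 * a * b + (a + b) * (c + d)
    expand = solve-∀
    factor : ∀ a b c d → (a + b) * (a + b) + (a + b) * (c + d) ≡ (a + b + c + d) * (a + b)
    factor = solve-∀

  walks₄-≤ : 4 * walks₄ g h ≤ n * n * hamming g h
  walks₄-≤ = begin
    4 * walks₄ g h
      ≡⟨ cong (4 *_) (∑-differing λ u v → colour g (not u) * colour h (not v)) ⟩
    4 * (colour g false * colour h true * A + colour g true * colour h false * B)
      ≡⟨ cong₂ (λ p q → 4 * (p * A + q * B)) (cong₂ _*_ colour-g-false colour-h-true)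
                                             (cong₂ _*_ colour-g-true colour-h-false) ⟩
    4 * ((B + C) * (B + D) * A + (A + D) * (A + C) * B)
      ≡⟨ expand A B C D ⟩
    (A + B) * (4 * A * B) + 2 * (C + D) * (4 * A * B) + (A + B) * (4 * C * D)
      ≤⟨ +-mono-≤ (+-mono-≤ (*-monoʳ-≤ (A + B) (4*m*n≤[m+n]² A B))
                            (*-monoʳ-≤ (2 * (C + D)) (4*m*n≤[m+n]² A B)))
                  (*-monoʳ-≤ (A + B) (4*m*n≤[m+n]² C D)) ⟩
    (A + B) * ((A + B) * (A + B)) + 2 * (C + D) * ((A + B) * (A + B)) + (A + B) * ((C + D) * (C + D))
      ≡⟨ factor A B C D ⟩
    (A + B + C + D) * (A + B + C + D) * (A + B)
      ≡⟨ sym (cong₂ _*_ (cong₂ _*_ n≡A+B+C+D n≡A+B+C+D) hamming≡A+B) ⟩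
    n * n * hamming g h ∎
    where
    open ≤-Reasoning
    expand : ∀ a b c d → 4 * ((b + c) * (b + d) * a + (a + d) * (a + c) * b)
                         ≡ (a + b) * (4 * a * b) + 2 * (c + d) * (4 * a * b) + (a + b) * (4 * c * d)
    expand = solve-∀
    factor : ∀ a b c d → (a + b) * ((a + b) * (a + b)) + 2 * (c + d) * ((a + b) * (a + b))
                         + (a + b) * ((c + d) * (c + d))
                         ≡ (a + b + c + d) * (a + b + c + d) * (a + b)
    factor = solve-∀

∑∑diff-≤ : ∀ {m} (z : Fin m → Bool) → 2 * ∑[ x < m ] ∑[ x′ < m ] diff (z x) (z x′) ≤ m * m
∑∑diff-≤ {m} z = begin
  2 * ∑[ x < m ] colour z (not (z x))
    ≡⟨ cong (2 *_) (∑-byColour z (colour z ∘ not)) ⟩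
  2 * (colour z false * colour z true + colour z true * colour z false)
    ≡⟨ lemma (colour z true) (colour z false) ⟩
  4 * colour z true * colour z false
    ≤⟨ 4*m*n≤[m+n]² (colour z true) (colour z false) ⟩
  (colour z true + colour z false) * (colour z true + colour z false)
    ≡⟨ sym (cong₂ _*_ m≡ m≡) ⟩
  m * m ∎
  where
  open ≤-Reasoning
  lemma : ∀ r s → 2 * (s * r + r * s) ≡ 4 * r * s
  lemma = solve-∀
  m≡ : m ≡ colour z true + colour z false
  m≡ = trans (sym (∑-one m)) (trans (∑-byColour z (λ _ → 1)) (unit (colour z true) (colour z false)))
    where unit : ∀ r s → 1 * r + 1 * s ≡ r + s
          unit = solve-∀

∑∑hamming-≤ : ∀ {m n} (c : Fin m → Fin n → Bool) →
              2 * ∑[ x < m ] ∑[ x′ < m ] hamming (c x) (c x′) ≤ n * (m * m)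
∑∑hamming-≤ {m} {n} c = begin
  2 * ∑[ x < m ] ∑[ x′ < m ] ∑[ y < n ] diff (c x y) (c x′ y)
    ≡⟨ cong (2 *_) (trans (sum-cong-≗ λ x → ∑-comm λ x′ y → diff (c x y) (c x′ y))
                          (∑-comm λ x y → ∑[ x′ < m ] diff (c x y) (c x′ y))) ⟩
  2 * ∑[ y < n ] ∑[ x < m ] ∑[ x′ < m ] diff (c x y) (c x′ y)
    ≡⟨ *-distribˡ-sum 2 (λ y → ∑[ x < m ] ∑[ x′ < m ] diff (c x y) (c x′ y)) ⟩
  ∑[ y < n ] (2 * ∑[ x < m ] ∑[ x′ < m ] diff (c x y) (c x′ y))
    ≤⟨ ∑-mono-≤ (λ y → ∑∑diff-≤ (λ x → c x y)) ⟩
  ∑[ y < n ] (m * m)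
    ≡⟨ ∑-const n (m * m) ⟩
  n * (m * m) ∎
  where open ≤-Reasoning

∑∑-≤-hamming : ∀ {m n} (c : Fin m → Fin n → Bool) (w : Fin m → Fin m → ℕ) k →
               (∀ x x′ → w x x′ ≤ k * hamming (c x) (c x′)) →
               2 * ∑[ x < m ] ∑[ x′ < m ] w x x′ ≤ k * (n * (m * m))
∑∑-≤-hamming {m} {n} c w k w≤ = begin
  2 * ∑[ x < m ] ∑[ x′ < m ] w x x′
    ≤⟨ *-monoʳ-≤ 2 (∑-mono-≤ λ x → ∑-mono-≤ λ x′ → w≤ x x′) ⟩
  2 * ∑[ x < m ] ∑[ x′ < m ] (k * hamming (c x) (c x′))
    ≡⟨ cong (2 *_) (sym (*-distribˡ-∑∑ k λ x x′ → hamming (c x) (c x′))) ⟩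
  2 * (k * H)
    ≡⟨ lemma k H ⟩
  k * (2 * H)
    ≤⟨ *-monoʳ-≤ k (∑∑hamming-≤ c) ⟩
  k * (n * (m * m)) ∎
  where
  open ≤-Reasoning
  H : ℕ
  H = ∑[ x < m ] ∑[ x′ < m ] hamming (c x) (c x′)
  lemma : ∀ k h → 2 * (k * h) ≡ k * (2 * h)
  lemma = solve-∀

module _ {m n : ℕ} (c : Coloring m n) where

  alternating₃ : Fin m → Fin n → Fin m → Fin n → ℕ
  alternating₃ x y′ x′ y = diff (c x y′) (c x′ y′) * diff (c x′ y′) (c x′ y)

  -- The middle pair of edges comes first, so that the sums over y and y′ factor out.
  alternating₄ : Fin n → Fin m → Fin n → Fin m → Fin n → ℕ
  alternating₄ y x₁ y₂ x₂ y′ = diff (c x₁ y₂) (c x₂ y₂) * (diff (c x₁ y₂) (c x₁ y) * diff (c x₂ y₂) (c x₂ y′))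

  altWalks₃ : Fin m → Fin n → ℕ
  altWalks₃ x y = ∑[ x′ < m ] ∑[ y′ < n ] alternating₃ x y′ x′ y

  altWalks₄ : Fin n → Fin n → ℕ
  altWalks₄ y y′ = ∑[ x₁ < m ] ∑[ x₂ < m ] ∑[ y₂ < n ] alternating₄ y x₁ y₂ x₂ y′

  ∑altWalks₃≡∑∑walks₃ : ∑[ x < m ] ∑[ y < n ] altWalks₃ x y ≡ ∑[ x < m ] ∑[ x′ < m ] walks₃ (c x) (c x′)
  ∑altWalks₃≡∑∑walks₃ = begin
    ∑[ x < m ] ∑[ y < n ] ∑[ x′ < m ] ∑[ y′ < n ] alternating₃ x y′ x′ y
      ≡⟨ sum-cong-≗ (λ x → ∑-comm λ y x′ → ∑[ y′ < n ] alternating₃ x y′ x′ y) ⟩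
    ∑[ x < m ] ∑[ x′ < m ] ∑[ y < n ] ∑[ y′ < n ] alternating₃ x y′ x′ y
      ≡⟨ sum-cong-≗ (λ x → sum-cong-≗ λ x′ → ∑-comm λ y y′ → alternating₃ x y′ x′ y) ⟩
    ∑[ x < m ] ∑[ x′ < m ] ∑[ y′ < n ] ∑[ y < n ] alternating₃ x y′ x′ y
      ≡⟨ sum-cong-≗ (λ x → sum-cong-≗ λ x′ → sum-cong-≗ λ y′ →
           sym (*-distribˡ-sum (diff (c x y′) (c x′ y′)) (λ y → diff (c x′ y′) (c x′ y)))) ⟩
    ∑[ x < m ] ∑[ x′ < m ] walks₃ (c x) (c x′) ∎
    where open ≡-Reasoning

  ∑altWalks₄≡∑∑walks₄ : ∑[ y < n ] ∑[ y′ < n ] altWalks₄ y y′ ≡ ∑[ x₁ < m ] ∑[ x₂ < m ] walks₄ (c x₁) (c x₂)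
  ∑altWalks₄≡∑∑walks₄ = begin
    ∑[ y < n ] ∑[ y′ < n ] ∑[ x₁ < m ] ∑[ x₂ < m ] ∑[ y₂ < n ] alternating₄ y x₁ y₂ x₂ y′
      ≡⟨ sum-cong-≗ (λ y → ∑-inward₃ λ y′ x₁ x₂ y₂ → alternating₄ y x₁ y₂ x₂ y′) ⟩
    ∑[ y < n ] ∑[ x₁ < m ] ∑[ x₂ < m ] ∑[ y₂ < n ] ∑[ y′ < n ] alternating₄ y x₁ y₂ x₂ y′
      ≡⟨ ∑-inward₃ (λ y x₁ x₂ y₂ → ∑[ y′ < n ] alternating₄ y x₁ y₂ x₂ y′) ⟩
    ∑[ x₁ < m ] ∑[ x₂ < m ] ∑[ y₂ < n ] ∑[ y < n ] ∑[ y′ < n ] alternating₄ y x₁ y₂ x₂ y′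
      ≡⟨ sum-cong-≗ (λ x₁ → sum-cong-≗ λ x₂ → sum-cong-≗ λ y₂ →
           ∑∑-factor (diff (c x₁ y₂) (c x₂ y₂)) (diff (c x₁ y₂) ∘ c x₁) (diff (c x₂ y₂) ∘ c x₂)) ⟩
    ∑[ x₁ < m ] ∑[ x₂ < m ] walks₄ (c x₁) (c x₂) ∎
    where open ≡-Reasoning

  ∑altWalks₃-≤ : 4 * ∑[ x < m ] ∑[ y < n ] altWalks₃ x y ≤ n * (n * (m * m))
  ∑altWalks₃-≤ = begin
    4 * ∑[ x < m ] ∑[ y < n ] altWalks₃ x y
      ≡⟨ cong (4 *_) ∑altWalks₃≡∑∑walks₃ ⟩
    4 * W
      ≡⟨ double W ⟩
    2 * (W + W)
      ≡⟨ cong (2 *_) (∑∑-+-transpose λ x x′ → walks₃ (c x) (c x′)) ⟩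
    2 * ∑[ x < m ] ∑[ x′ < m ] (walks₃ (c x) (c x′) + walks₃ (c x′) (c x))
      ≤⟨ ∑∑-≤-hamming c _ n (λ x x′ → RowPair.walks₃-≤ (c x) (c x′)) ⟩
    n * (n * (m * m)) ∎
    where
    open ≤-Reasoning
    W : ℕ
    W = ∑[ x < m ] ∑[ x′ < m ] walks₃ (c x) (c x′)
    double : ∀ w → 4 * w ≡ 2 * (w + w)
    double = solve-∀

  ∑altWalks₄-≤ : 8 * ∑[ y < n ] ∑[ y′ < n ] altWalks₄ y y′ ≤ n * n * (n * (m * m))
  ∑altWalks₄-≤ = begin
    8 * ∑[ y < n ] ∑[ y′ < n ] altWalks₄ y y′
      ≡⟨ cong (8 *_) ∑altWalks₄≡∑∑walks₄ ⟩
    8 * W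
      ≡⟨ regroup W ⟩
    2 * (4 * W)
      ≡⟨ cong (2 *_) (*-distribˡ-∑∑ 4 λ x₁ x₂ → walks₄ (c x₁) (c x₂)) ⟩
    2 * ∑[ x₁ < m ] ∑[ x₂ < m ] (4 * walks₄ (c x₁) (c x₂))
      ≤⟨ ∑∑-≤-hamming c _ (n * n) (λ x₁ x₂ → RowPair.walks₄-≤ (c x₁) (c x₂)) ⟩
    n * n * (n * (m * m)) ∎
    where
    open ≤-Reasoning
    W : ℕ
    W = ∑[ x₁ < m ] ∑[ x₂ < m ] walks₄ (c x₁) (c x₂)
    regroup : ∀ w → 8 * w ≡ 2 * (4 * w)
    regroup = solve-∀

connected⇒injective-codes : ∀ {m n ℓ t} {c : Coloring m n} {s s′ : Vertex m n} {Q : Set} {ok : Q → Set}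
  (code : Q → List (Vertex m n)) →
  ((p : AltPath c ℓ s s′) → Σ Q λ q → AltPath.vs p ≡ code q × ok q) →
  ConnectedBy c ℓ s s′ t → Σ (Fin t → Q) λ f → Injective _≡_ _≡_ f × (∀ i → ok (f i))
connected⇒injective-codes code decode (P , distinct) =
  proj₁ ∘ decode ∘ P ,
  (λ {i} {j} eq → distinct i j (trans (vs≡ i) (trans (cong code eq) (sym (vs≡ j))))) ,
  proj₂ ∘ proj₂ ∘ decode ∘ P
  where
  vs≡ : ∀ i → AltPath.vs (P i) ≡ code (proj₁ (decode (P i)))
  vs≡ i = proj₁ (proj₂ (decode (P i)))

module _ {m n : ℕ} {c : Coloring m n} where

  decode₃ : ∀ {x y} (p : AltPath c 3 (inj₁ x) (inj₂ y)) →
            Σ (Fin m × Fin n) λ (x′ , y′) →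
              AltPath.vs p ≡ inj₁ x ∷ inj₂ y′ ∷ inj₁ x′ ∷ inj₂ y ∷ [] × 1 ≤ alternating₃ c x y′ x′ y
  decode₃ record { vs = inj₁ _ ∷ inj₂ y′ ∷ inj₁ x′ ∷ inj₂ _ ∷ [] ; len = refl ; start = refl ; end = refl
                 ; alt = _ , e₁ , _ , _ , e₂ , n₂ , _ , e₃ , n₃ , _ } =
    (x′ , y′) , refl , ≤-reflexive (sym (cong₂ _*_ (colours≢⇒diff≡1 e₁ e₂ n₂) (colours≢⇒diff≡1 e₂ e₃ n₃)))
  decode₃ record { vs = inj₁ _ ∷ inj₁ _ ∷ _ ∷ _ ∷ [] ; len = refl ; alt = _ , () , _ }
  decode₃ record { vs = inj₁ _ ∷ inj₂ _ ∷ inj₂ _ ∷ _ ∷ [] ; len = refl ; alt = _ , _ , _ , _ , () , _ }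
  decode₃ record { vs = inj₁ _ ∷ inj₂ _ ∷ inj₁ _ ∷ inj₁ _ ∷ [] ; len = refl ; end = () }
  decode₃ record { vs = inj₂ _ ∷ _ ∷ _ ∷ _ ∷ [] ; len = refl ; start = () }
  decode₃ record { vs = [] ; len = () }
  decode₃ record { vs = _ ∷ [] ; len = () }
  decode₃ record { vs = _ ∷ _ ∷ [] ; len = () }
  decode₃ record { vs = _ ∷ _ ∷ _ ∷ [] ; len = () }
  decode₃ record { vs = _ ∷ _ ∷ _ ∷ _ ∷ _ ∷ _ ; len = () }

  decode₄ : ∀ {y y′} (p : AltPath c 4 (inj₂ y) (inj₂ y′)) →
            Σ (Fin m × Fin m × Fin n) λ (x₁ , x₂ , y₂) →
              AltPath.vs p ≡ inj₂ y ∷ inj₁ x₁ ∷ inj₂ y₂ ∷ inj₁ x₂ ∷ inj₂ y′ ∷ [] × 1 ≤ alternating₄ c y x₁ y₂ x₂ y′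
  decode₄ record { vs = inj₂ _ ∷ inj₁ x₁ ∷ inj₂ y₂ ∷ inj₁ x₂ ∷ inj₂ _ ∷ [] ; len = refl ; start = refl ; end = refl
                 ; alt = _ , e₁ , _ , _ , e₂ , n₂ , _ , e₃ , n₃ , _ , e₄ , n₄ , _ } =
    (x₁ , x₂ , y₂) , refl ,
    ≤-reflexive (sym (cong₂ _*_ (colours≢⇒diff≡1 e₂ e₃ n₃)
                                (cong₂ _*_ (colours≢⇒diff≡1 e₂ e₁ (n₂ ∘ sym)) (colours≢⇒diff≡1 e₃ e₄ n₄))))
  decode₄ record { vs = inj₂ _ ∷ inj₂ _ ∷ _ ∷ _ ∷ _ ∷ [] ; len = refl ; alt = _ , () , _ }
  decode₄ record { vs = inj₂ _ ∷ inj₁ _ ∷ inj₁ _ ∷ _ ∷ _ ∷ [] ; len = refl ; alt = _ , _ , _ , _ , () , _ }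
  decode₄ record { vs = inj₂ _ ∷ inj₁ _ ∷ inj₂ _ ∷ inj₂ _ ∷ _ ∷ [] ; len = refl
                 ; alt = _ , _ , _ , _ , _ , _ , _ , () , _ }
  decode₄ record { vs = inj₂ _ ∷ inj₁ _ ∷ inj₂ _ ∷ inj₁ _ ∷ inj₁ _ ∷ [] ; len = refl ; end = () }
  decode₄ record { vs = inj₁ _ ∷ _ ∷ _ ∷ _ ∷ _ ∷ [] ; len = refl ; start = () }
  decode₄ record { vs = [] ; len = () }
  decode₄ record { vs = _ ∷ [] ; len = () }
  decode₄ record { vs = _ ∷ _ ∷ [] ; len = () }
  decode₄ record { vs = _ ∷ _ ∷ _ ∷ [] ; len = () }
  decode₄ record { vs = _ ∷ _ ∷ _ ∷ _ ∷ [] ; len = () }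
  decode₄ record { vs = _ ∷ _ ∷ _ ∷ _ ∷ _ ∷ _ ∷ _ ; len = () }

  connected⇒≤altWalks₃ : ∀ {x y t} → ConnectedBy c 3 (inj₁ x) (inj₂ y) t → t ≤ altWalks₃ c x y
  connected⇒≤altWalks₃ {x} {y} connected =
    let f , f-injective , weighted = connected⇒injective-codes _ decode₃ connected
    in  injective⇒≤-∑∑ (λ x′ y′ → alternating₃ c x y′ x′ y) f f-injective weighted

  connected⇒≤altWalks₄ : ∀ {y y′ t} → ConnectedBy c 4 (inj₂ y) (inj₂ y′) t → t ≤ altWalks₄ c y y′
  connected⇒≤altWalks₄ {y} {y′} connected =
    let f , f-injective , weighted = connected⇒injective-codes _ decode₄ connected
    in  injective⇒≤-∑∑∑ (λ x₁ x₂ y₂ → alternating₄ c y x₁ y₂ x₂ y′) f f-injective weighted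

λ₃-bound : (m n : ℕ) → 1 ≤ m → m ≤ n → (t : ℕ) → Achievable 3 m n t → 4 * t ≤ m * n
λ₃-bound m@(suc _) n@(suc _) _ _ t (c , connected) = *-cancelˡ-≤ (m * n) (begin
  m * n * (4 * t)                          ≡⟨ regroup m n t ⟩
  4 * (m * (n * t))                        ≡⟨ cong (4 *_) (sym (∑∑-const m n t)) ⟩
  4 * ∑[ x < m ] ∑[ y < n ] t              ≤⟨ *-monoʳ-≤ 4 (∑-mono-≤ λ x → ∑-mono-≤ λ y →
                                                 connected⇒≤altWalks₃ (connected x y)) ⟩
  4 * ∑[ x < m ] ∑[ y < n ] altWalks₃ c x y ≤⟨ ∑altWalks₃-≤ c ⟩
  n * (n * (m * m))                        ≡⟨ square m n ⟩
  m * n * (m * n)                          ∎)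
  where
  open ≤-Reasoning
  regroup : ∀ m n t → m * n * (4 * t) ≡ 4 * (m * (n * t))
  regroup = solve-∀
  square : ∀ m n → n * (n * (m * m)) ≡ m * n * (m * n)
  square = solve-∀
λ₃-bound zero    _    () _  _ _
λ₃-bound (suc _) zero _  () _ _

achievable₄-≤ : ∀ {m n t} → Achievable 4 m (suc n) t → 8 * (n * t) ≤ suc n * (suc n * (m * m))
achievable₄-≤ {m} {n} {t} (c , connected) = *-cancelˡ-≤ (suc n) (begin
  suc n * (8 * (n * t))                               ≡⟨ regroup (suc n) (n * t) ⟩
  8 * (suc n * (n * t))                               ≤⟨ *-monoʳ-≤ 8 (off-diagonal-≤-∑∑ (altWalks₄ c)
                                                          λ y y′ y≢y′ → connected⇒≤altWalks₄ (connected y y′ y≢y′)) ⟩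
  8 * ∑[ y < suc n ] ∑[ y′ < suc n ] altWalks₄ c y y′ ≤⟨ ∑altWalks₄-≤ c ⟩
  suc n * suc n * (suc n * (m * m))                   ≡⟨ *-assoc (suc n) (suc n) (suc n * (m * m)) ⟩
  suc n * (suc n * (suc n * (m * m)))                 ∎)
  where
  open ≤-Reasoning
  regroup : ∀ n s → n * (8 * s) ≡ 8 * (n * s)
  regroup = solve-∀

λ₄-bound : (k : ℕ) → ∃[ N ] ((m n : ℕ) → N ≤ n → 1 ≤ m → m ≤ n → (t : ℕ) →
             Achievable 4 m n t → 8 * suc k * t ≤ (suc k + 1) * (m * m * n))
λ₄-bound k = 2 + k , bound  -- n ≥ k + 2 gives n/(n − 1) ≤ (k + 2)/(k + 1)
  where
  bound : (m n : ℕ) → 2 + k ≤ n → 1 ≤ m → m ≤ n → (t : ℕ) →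
          Achievable 4 m n t → 8 * suc k * t ≤ (suc k + 1) * (m * m * n)
  bound m (suc n) (s≤s k<n) _ _ t achievable = *-cancelˡ-≤ (suc n) (begin
    suc n * (8 * suc k * t)                    ≡⟨ regroup₁ (suc n) (suc k) t ⟩
    8 * t * (suc k * suc n)                    ≤⟨ *-monoʳ-≤ (8 * t) (a≤n⇒a*[1+n]≤[a+1]*n k<n) ⟩
    8 * t * ((suc k + 1) * n)                  ≡⟨ regroup₂ (suc k + 1) n t ⟩
    (suc k + 1) * (8 * (n * t))                ≤⟨ *-monoʳ-≤ (suc k + 1) (achievable₄-≤ achievable) ⟩
    (suc k + 1) * (suc n * (suc n * (m * m)))  ≡⟨ regroup₃ (suc k + 1) (suc n) m ⟩
    suc n * ((suc k + 1) * (m * m * suc n))    ∎)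
    where
    open ≤-Reasoning
    regroup₁ : ∀ n a t → n * (8 * a * t) ≡ 8 * t * (a * n)
    regroup₁ = solve-∀
    regroup₂ : ∀ a n t → 8 * t * (a * n) ≡ a * (8 * (n * t))
    regroup₂ = solve-∀
    regroup₃ : ∀ a n m → a * (n * (n * (m * m))) ≡ n * (a * (m * m * n))
    regroup₃ = solve-∀

theorem4p2 : ((m n : ℕ) → 1 ≤ m → m ≤ n → (t : ℕ) → Achievable 3 m n t → 4 * t ≤ m * n)
    × ((k : ℕ) → ∃[ N ] ((m n : ℕ) → N ≤ n → 1 ≤ m → m ≤ n → (t : ℕ) →
    Achievable 4 m n t → 8 * suc k * t ≤ (suc k + 1) * (m * m * n)))
theorem4p2 = λ₃-bound , λ₄-bound
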